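{- Let $\mathcal{G}=(V,E_1,\dots,E_\tau)$ be a temporal graph with layers $G_i=(V,E_i)$, let $1\le a\le b\le\tau$, let $C$ be a clique in $\bigcap_{t=a}^bG_t=(V,\bigcap_{t=a}^bE_t)$, and let $c>0$. Then the following implications hold: (1) if $(C,[a,b])$ is alltime-max-$c$-isolated, then it is avg-alltime-$c$-isolated and usually-max-$c$-isolated; (2) if $(C,[a,b])$ is avg-alltime-$c$-isolated, then it is alltime-avg-$c$-isolated; (3) if $(C,[a,b])$ is usually-max-$c$-isolated, then it is max-usually-$c$-isolated; (4) if $(C,[a,b])$ is alltime-avg-$c$-isolated, then it is usually-avg-$c$-isolated; (5) if $(C,[a,b])$ is max-usually-$c$-isolated, then it is usually-avg-$c$-isolated and $C$ is max-$c$-isolated in $\bigcap_{i=a}^bG_i$; (6) if $(C,[a,b])$ is usually-avg-$c$-isolated, then $C$ is avg-$c$-isolated in $\bigcap_{i=a}^bG_i$; (7) if $C$ is max-$c$-isolated in $\bigcap_{i=a}^bG_i$, then it is avg-$c$-isolated in $\bigcap_{i=a}^bG_i$.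
   Context: Graphs are simple and undirected. For a static graph $G$ and $v\in A\subseteq V(G)$, $\mathrm{outdeg}_G(v,A)$ is the number of edges with one endpoint $v$ and the other outside $A$, and $\mathrm{outdeg}_G(A)=\sum_{v\in A}\mathrm{outdeg}_G(v,A)$. In a static graph $G$, a clique $C$ is avg-$c$-isolated if $\mathrm{outdeg}_G(C)<c|C|$, and max-$c$-isolated if $\max_{v\in C}\mathrm{outdeg}_G(v,C)<c$. Since $C$ is a clique in each layer $G_i$, $i\in[a,b]$, the pair $(C,[a,b])$ is a temporal clique, and it is called - alltime-avg-$c$-isolated if $\max_{i\in[a,b]}\sum_{v\in C}\mathrm{outdeg}_{G_i}(v,C)<c|C|$; - alltime-max-$c$-isolated if $\max_{v\in C}\max_{i\in[a,b]}\mathrm{outdeg}_{G_i}(v,C)<c$; - avg-alltime-$c$-isolated if $\sum_{v\in C}\max_{i\in[a,b]}\mathrm{outdeg}_{G_i}(v,C)<c|C|$; - max-usually-$c$-isolated if $\max_{v\in C}\sum_{i=a}^b\mathrm{outdeg}_{G_i}(v,C)<c(b+1-a)$; - usually-avg-$c$-isolated if $\sum_{i=a}^b\sum_{v\in C}\mathrm{outdeg}_{G_i}(v,C)<c|C|(b+1-a)$; - usually-max-$c$-isolated if $\sum_{i=a}^b\max_{v\in C}\mathrm{outdeg}_{G_i}(v,C)<c(b+1-a)$.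
   Formalization: The parameter c ranges over the positive rationals. -}

module Defs where

open import Data.Bool using (Bool; true; false; _∧_; not; if_then_else_)
open import Data.Nat using (ℕ; zero; suc; _+_; _∸_; _⊔_; _≤_)
open import Data.Fin using (Fin)
open import Data.Fin.Subset using (Subset; _∈_; ∣_∣; Nonempty)
open import Data.Vec using (lookup)
open import Data.List using (List; []; _∷_; map; filter; foldr; upTo; allFin)
open import Data.Nat.ListAction using (sum)
open import Data.Bool.Properties using (∧-comm)
open import Data.Integer as ℤ using ()
open import Data.Rational using (ℚ; _/_; _*_; _<_)
open import Relation.Binary.PropositionalEquality using (_≡_; _≢_; refl; cong₂)
open import Relation.Nullary.Decidable using (Dec)
open import Data.Bool using (T)
open import Data.Bool.Properties using (T?)

record SimpleGraph (n : ℕ) : Set where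
  field
    adj    : Fin n → Fin n → Bool
    sym    : ∀ u v → adj u v ≡ adj v u
    irrefl : ∀ v → adj v v ≡ false
open SimpleGraph public

-- A temporal graph (V, E_1, …, E_τ) with V = Fin n: lifetime τ and
-- layers G_i indexed by naturals; only the layers i with 1 ≤ i ≤ τ
-- are ever used (the theorem assumes 1 ≤ a ≤ b ≤ τ).
record TemporalGraph (n : ℕ) : Set where
  field
    τ     : ℕ
    layer : ℕ → SimpleGraph n
open TemporalGraph public

interval : ℕ → ℕ → List ℕ
interval a b = map (λ k → a + k) (upTo (suc (b ∸ a)))

allAdj : ∀ {n} → (ℕ → SimpleGraph n) → List ℕ → Fin n → Fin n → Bool
allAdj G []       u v = true
allAdj G (i ∷ is) u v = adj (G i) u v ∧ allAdj G is u v

allAdj-sym : ∀ {n} (G : ℕ → SimpleGraph n) is u v → allAdj G is u v ≡ allAdj G is v u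
allAdj-sym G []       u v = refl
allAdj-sym G (i ∷ is) u v = cong₂ _∧_ (sym (G i) u v) (allAdj-sym G is u v)

interval-irrefl : ∀ {n} (G : ℕ → SimpleGraph n) a b v → allAdj G (interval a b) v v ≡ false
interval-irrefl G a b v with adj (G (a + 0)) v v | irrefl (G (a + 0)) v
... | false | refl = refl

intersectionGraph : ∀ {n} → TemporalGraph n → ℕ → ℕ → SimpleGraph n
intersectionGraph 𝒢 a b = record
  { adj    = allAdj (layer 𝒢) (interval a b)
  ; sym    = allAdj-sym (layer 𝒢) (interval a b)
  ; irrefl = interval-irrefl (layer 𝒢) a b
  }

IsClique : ∀ {n} → SimpleGraph n → Subset n → Set
IsClique G C = ∀ u v → u ∈ C → v ∈ C → u ≢ v → T (adj G u v)

-- Finite sums / maxima over lists (max of the empty list is 0;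
-- it is only ever taken over nonempty lists below).
maxL : List ℕ → ℕ
maxL = foldr _⊔_ 0

members : ∀ {n} → Subset n → List (Fin n)
members {n} C = filter (λ v → T? (lookup C v)) (allFin n)

outdegV : ∀ {n} → SimpleGraph n → Subset n → Fin n → ℕ
outdegV {n} G C v =
  sum (map (λ u → if adj G v u ∧ not (lookup C u) then 1 else 0) (allFin n))

outdeg : ∀ {n} → SimpleGraph n → Subset n → ℕ
outdeg G C = sum (map (outdegV G C) (members C))

maxOutdeg : ∀ {n} → SimpleGraph n → Subset n → ℕ
maxOutdeg G C = maxL (map (outdegV G C) (members C))

ℕ→ℚ : ℕ → ℚ
ℕ→ℚ k = (ℤ.+ k) / 1

AvgIsolated : ∀ {n} → ℚ → SimpleGraph n → Subset n → Set
AvgIsolated c G C = ℕ→ℚ (outdeg G C) < c * ℕ→ℚ ∣ C ∣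

MaxIsolated : ∀ {n} → ℚ → SimpleGraph n → Subset n → Set
MaxIsolated c G C = ℕ→ℚ (maxOutdeg G C) < c

module _ {n : ℕ} (c : ℚ) (𝒢 : TemporalGraph n) (C : Subset n) (a b : ℕ) where
  private
    G : ℕ → SimpleGraph n
    G = layer 𝒢
    len : ℕ
    len = b + 1 ∸ a
    maxI : (ℕ → ℕ) → ℕ
    maxI f = maxL (map f (interval a b))
    sumI : (ℕ → ℕ) → ℕ
    sumI f = sum (map f (interval a b))
    maxC : (Fin n → ℕ) → ℕ
    maxC g = maxL (map g (members C))
    sumC : (Fin n → ℕ) → ℕ
    sumC g = sum (map g (members C))

  AlltimeAvgIsolated : Set
  AlltimeAvgIsolated =
    ℕ→ℚ (maxI (λ i → sumC (λ v → outdegV (G i) C v))) < c * ℕ→ℚ ∣ C ∣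

  AlltimeMaxIsolated : Set
  AlltimeMaxIsolated =
    ℕ→ℚ (maxC (λ v → maxI (λ i → outdegV (G i) C v))) < c

  AvgAlltimeIsolated : Set
  AvgAlltimeIsolated =
    ℕ→ℚ (sumC (λ v → maxI (λ i → outdegV (G i) C v))) < c * ℕ→ℚ ∣ C ∣

  MaxUsuallyIsolated : Set
  MaxUsuallyIsolated =
    ℕ→ℚ (maxC (λ v → sumI (λ i → outdegV (G i) C v))) < c * ℕ→ℚ len

  UsuallyAvgIsolated : Set
  UsuallyAvgIsolated =
    ℕ→ℚ (sumI (λ i → sumC (λ v → outdegV (G i) C v))) < c * ℕ→ℚ ∣ C ∣ * ℕ→ℚ len

  UsuallyMaxIsolated : Set
  UsuallyMaxIsolated =
    ℕ→ℚ (sumI (λ i → maxC (λ v → outdegV (G i) C v))) < c * ℕ→ℚ len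

-- Each
-- implication is one of four elementary facts: a sum is at most its length times its maximum,
-- a maximum of sums is at most the sum of the maxima, maxima commute with maxima and sums with
-- sums, and the out-degree in the intersection graph is at most the out-degree in every layer.
module Submission where

open import Defs hiding (sym)
open import Data.Bool using (Bool; true; false; _∧_; not; if_then_else_; T)
open import Data.Bool.Properties using (T?; T-∧)
open import Data.Nat as ℕ using (ℕ; zero; suc; _+_; _*_; _∸_; _⊔_; _≤_; z≤n; s≤s)
open import Data.Nat.Properties
open import Data.Nat.ListAction using (sum)
open import Data.Fin using (Fin)
open import Data.List using (List; []; _∷_; map; filter; allFin; length; tabulate; upTo)
open import Data.List.Properties using (length-map; length-upTo)
open import Data.List.Membership.Propositional using (_∈_)
open import Data.List.Relation.Unary.Any using (here; there)
open import Data.Vec as Vec using (lookup)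
open import Data.Vec.Properties using (tabulate∘lookup)
open import Data.Fin.Subset using (Subset; ∣_∣; Nonempty)
open import Data.Fin.Subset.Properties using (∣p∣≤∣x∷p∣)
open import Data.Integer as ℤ using ()
open import Data.Integer.Properties as ℤ using ()
open import Data.Rational as ℚ using (ℚ; mkℚ; 0ℚ; _<_)
open import Data.Rational.Properties as ℚ using ()
open import Data.Nat.Coprimality as Coprimality using ()
open import Data.Product using (_,_; _×_; proj₁; proj₂)
open import Data.Empty using (⊥-elim)
open import Function using (_∘_; Equivalence)
open import Algebra.Bundles using (CommutativeMonoid)
open import Algebra.Properties.CommutativeSemigroup
  (CommutativeMonoid.commutativeSemigroup ℚ.*-1-commutativeMonoid) using (xy∙z≈xz∙y)
open import Relation.Binary.PropositionalEquality

ℕ→ℚ≡mkℚ : ∀ k → ℕ→ℚ k ≡ mkℚ (ℤ.+ k) 0 (Coprimality.sym (Coprimality.1-coprimeTo k))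
ℕ→ℚ≡mkℚ k = ℚ.normalize-coprime (Coprimality.sym (Coprimality.1-coprimeTo k))

ℕ→ℚ-* : ∀ x y → ℕ→ℚ (x * y) ≡ ℕ→ℚ x ℚ.* ℕ→ℚ y
ℕ→ℚ-* x y = begin
  ℕ→ℚ (x * y)                          ≡⟨ cong (ℚ._/ 1) (ℤ.pos-* x y) ⟩
  (ℤ.+ x ℤ.* ℤ.+ y) ℚ./ 1              ≡⟨ cong₂ ℚ._*_ (ℕ→ℚ≡mkℚ x) (ℕ→ℚ≡mkℚ y) ⟨
  ℕ→ℚ x ℚ.* ℕ→ℚ y                      ∎
  where open ≡-Reasoning

ℕ→ℚ-mono-≤ : ∀ {x y} → x ≤ y → ℕ→ℚ x ℚ.≤ ℕ→ℚ y
ℕ→ℚ-mono-≤ {x} {y} x≤y rewrite ℕ→ℚ≡mkℚ x | ℕ→ℚ≡mkℚ y =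
  ℚ.*≤* (subst₂ ℤ._≤_ (sym (ℤ.*-identityʳ (ℤ.+ x))) (sym (ℤ.*-identityʳ (ℤ.+ y))) (ℤ.+≤+ x≤y))

ℕ→ℚ-≤-<-trans : ∀ {s t} q → s ≤ t → ℕ→ℚ t < q → ℕ→ℚ s < q
ℕ→ℚ-≤-<-trans q s≤t t<q = ℚ.≤-<-trans (ℕ→ℚ-mono-≤ s≤t) t<q

ℕ→ℚ-*-≤-<-trans : ∀ {s x k} q → 0 ℕ.< k → s ≤ k * x → ℕ→ℚ x < q → ℕ→ℚ s < q ℚ.* ℕ→ℚ k
ℕ→ℚ-*-≤-<-trans {s} {x} {suc k} q _ s≤kx x<q =
  ℕ→ℚ-≤-<-trans _ (subst (s ≤_) (*-comm (suc k) x) s≤kx)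
    (subst (_< q ℚ.* ℕ→ℚ (suc k)) (sym (ℕ→ℚ-* x (suc k)))
      (ℚ.*-monoˡ-<-pos (ℕ→ℚ (suc k)) {{ℚ.normalize-pos (suc k) 1}} x<q))

ℕ→ℚ-*-cancel-< : ∀ {s x k} q → 0 ℕ.< k → k * x ≤ s → ℕ→ℚ s < q ℚ.* ℕ→ℚ k → ℕ→ℚ x < q
ℕ→ℚ-*-cancel-< {s} {x} {suc k} q _ kx≤s s<qk =
  ℚ.*-cancelʳ-<-nonNeg (ℕ→ℚ (suc k)) {{ℚ.normalize-nonNeg (suc k) 1}}
    (ℚ.≤-<-trans (subst (ℚ._≤ ℕ→ℚ s) (ℕ→ℚ-* x (suc k))
                   (ℕ→ℚ-mono-≤ (subst (_≤ s) (*-comm (suc k) x) kx≤s)))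
                 s<qk)

module _ {A : Set} where

  sum-map-mono : ∀ (xs : List A) {f g : A → ℕ} → (∀ {x} → x ∈ xs → f x ≤ g x) →
                 sum (map f xs) ≤ sum (map g xs)
  sum-map-mono []       f≤g = z≤n
  sum-map-mono (x ∷ xs) f≤g = +-mono-≤ (f≤g (here refl)) (sum-map-mono xs (f≤g ∘ there))

  sum-map-≤-length* : ∀ (xs : List A) {f : A → ℕ} {B} → (∀ {x} → x ∈ xs → f x ≤ B) →
                      sum (map f xs) ≤ length xs * B
  sum-map-≤-length* []       f≤B = z≤n
  sum-map-≤-length* (x ∷ xs) f≤B = +-mono-≤ (f≤B (here refl)) (sum-map-≤-length* xs (f≤B ∘ there))

  length*-≤-sum-map : ∀ (xs : List A) {f : A → ℕ} {B} → (∀ {x} → x ∈ xs → B ≤ f x) →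
                      length xs * B ≤ sum (map f xs)
  length*-≤-sum-map []       B≤f = z≤n
  length*-≤-sum-map (x ∷ xs) B≤f = +-mono-≤ (B≤f (here refl)) (length*-≤-sum-map xs (B≤f ∘ there))

  sum-map-* : ∀ (xs : List A) (f : A → ℕ) k → sum (map (λ x → k * f x) xs) ≡ k * sum (map f xs)
  sum-map-* []       f k = sym (*-zeroʳ k)
  sum-map-* (x ∷ xs) f k = trans (cong (k * f x +_) (sum-map-* xs f k)) (sym (*-distribˡ-+ k (f x) _))

  sum-map-+ : ∀ (xs : List A) (f g : A → ℕ) →
              sum (map (λ x → f x + g x) xs) ≡ sum (map f xs) + sum (map g xs)
  sum-map-+ []       f g = refl
  sum-map-+ (x ∷ xs) f g = trans (cong (f x + g x +_) (sum-map-+ xs f g))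
                                 (+-+-comm (f x) (g x) _ _)
    where
    +-+-comm : ∀ p q r s → p + q + (r + s) ≡ p + r + (q + s)
    +-+-comm p q r s = begin
      p + q + (r + s)   ≡⟨ +-assoc p q (r + s) ⟩
      p + (q + (r + s)) ≡⟨ cong (p +_) (+-assoc q r s) ⟨
      p + (q + r + s)   ≡⟨ cong (λ t → p + (t + s)) (+-comm q r) ⟩
      p + (r + q + s)   ≡⟨ cong (p +_) (+-assoc r q s) ⟩
      p + (r + (q + s)) ≡⟨ +-assoc p r (q + s) ⟨
      p + r + (q + s)   ∎
      where open ≡-Reasoning

  sum-map-0 : ∀ (xs : List A) → sum (map (λ _ → 0) xs) ≡ 0
  sum-map-0 []       = refl
  sum-map-0 (x ∷ xs) = sum-map-0 xs

  ≤-maxL-map : ∀ {xs : List A} (f : A → ℕ) {x} → x ∈ xs → f x ≤ maxL (map f xs)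
  ≤-maxL-map {x ∷ xs} f (here refl) = m≤m⊔n (f x) _
  ≤-maxL-map {y ∷ xs} f (there x∈xs) = ≤-trans (≤-maxL-map f x∈xs) (m≤n⊔m (f y) _)

  maxL-map-lub : ∀ (xs : List A) {f : A → ℕ} {B} → (∀ {x} → x ∈ xs → f x ≤ B) →
                 maxL (map f xs) ≤ B
  maxL-map-lub []       f≤B = z≤n
  maxL-map-lub (x ∷ xs) f≤B = ⊔-lub (f≤B (here refl)) (maxL-map-lub xs (f≤B ∘ there))

  maxL-map-* : ∀ (xs : List A) (f : A → ℕ) k → maxL (map (λ x → k * f x) xs) ≡ k * maxL (map f xs)
  maxL-map-* []       f k = sym (*-zeroʳ k)
  maxL-map-* (x ∷ xs) f k = trans (cong (k * f x ⊔_) (maxL-map-* xs f k)) (sym (*-distribˡ-⊔ k (f x) _))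

  sum-map-≤-length*maxL : ∀ (xs : List A) (f : A → ℕ) → sum (map f xs) ≤ length xs * maxL (map f xs)
  sum-map-≤-length*maxL xs f = sum-map-≤-length* xs (≤-maxL-map f)

sum-map-comm : ∀ {A B : Set} (xs : List A) (ys : List B) (f : A → B → ℕ) →
  sum (map (λ x → sum (map (f x) ys)) xs) ≡ sum (map (λ y → sum (map (λ x → f x y) xs)) ys)
sum-map-comm []       ys f = sym (sum-map-0 ys)
sum-map-comm (x ∷ xs) ys f = trans (cong (sum (map (f x) ys) +_) (sum-map-comm xs ys f))
                                   (sym (sum-map-+ ys (f x) (λ y → sum (map (λ x → f x y) xs))))

module _ {A B : Set} (xs : List A) (ys : List B) (f : A → B → ℕ) where

  maxL-map-sum-≤-sum-map-maxL :
    maxL (map (λ y → sum (map (λ x → f x y) xs)) ys) ≤ sum (map (λ x → maxL (map (f x) ys)) xs)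
  maxL-map-sum-≤-sum-map-maxL =
    maxL-map-lub ys (λ y∈ys → sum-map-mono xs (λ _ → ≤-maxL-map (f _) y∈ys))

  maxL-map-maxL-≤ :
    maxL (map (λ y → maxL (map (λ x → f x y) xs)) ys) ≤ maxL (map (λ x → maxL (map (f x) ys)) xs)
  maxL-map-maxL-≤ =
    maxL-map-lub ys (λ y∈ys → maxL-map-lub xs (λ {x} x∈xs →
      ≤-trans (≤-maxL-map (f x) y∈ys) (≤-maxL-map (λ x → maxL (map (f x) ys)) x∈xs)))

length-filter-tabulate : ∀ {A : Set} {n} (h : Fin n → A) (p : A → Bool) →
  length (filter (T? ∘ p) (tabulate h)) ≡ ∣ Vec.tabulate (p ∘ h) ∣
length-filter-tabulate {n = zero}  h p = refl
length-filter-tabulate {n = suc n} h p with p (h Fin.zero) | length-filter-tabulate (h ∘ Fin.suc) p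
... | true  | eq = cong suc eq
... | false | eq = eq

length-members : ∀ {n} (C : Subset n) → length (members C) ≡ ∣ C ∣
length-members C = trans (length-filter-tabulate (λ v → v) (lookup C)) (cong ∣_∣ (tabulate∘lookup C))

nonempty⇒∣p∣>0 : ∀ {n} {p : Subset n} → Nonempty p → 0 ℕ.< ∣ p ∣
nonempty⇒∣p∣>0 (_ , Vec.here)                   = s≤s z≤n
nonempty⇒∣p∣>0 {p = x Vec.∷ p} (_ , Vec.there v∈p) = <-≤-trans (nonempty⇒∣p∣>0 (_ , v∈p)) (∣p∣≤∣x∷p∣ x p)

length-interval : ∀ {a b} → a ≤ b → length (interval a b) ≡ b + 1 ∸ a
length-interval {a} {b} a≤b = begin
  length (interval a b)         ≡⟨ length-map _ (upTo (suc (b ∸ a))) ⟩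
  length (upTo (suc (b ∸ a)))   ≡⟨ length-upTo (suc (b ∸ a)) ⟩
  suc (b ∸ a)                   ≡⟨ +-comm 1 (b ∸ a) ⟩
  b ∸ a + 1                     ≡⟨ +-∸-comm 1 a≤b ⟨
  b + 1 ∸ a                     ∎
  where open ≡-Reasoning

indicator-mono : ∀ {p p′} q → (T p → T p′) → (if p ∧ q then 1 else 0) ≤ (if p′ ∧ q then 1 else 0)
indicator-mono {false}          q p⇒p′ = z≤n
indicator-mono {true} {true}    q p⇒p′ = ≤-refl
indicator-mono {true} {false}   q p⇒p′ = ⊥-elim (p⇒p′ _)

outdegV-mono : ∀ {n} (G H : SimpleGraph n) C v → (∀ u → T (adj G v u) → T (adj H v u)) →
               outdegV G C v ≤ outdegV H C v
outdegV-mono {n} G H C v G⇒H = sum-map-mono (allFin n) (λ {u} _ → indicator-mono (not (lookup C u)) (G⇒H u))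

allAdj⇒adj : ∀ {n} (G : ℕ → SimpleGraph n) {is i} u v → i ∈ is → T (allAdj G is u v) → T (adj (G i) u v)
allAdj⇒adj G u v (here refl)  uv∈⋂ = proj₁ (Equivalence.to T-∧ uv∈⋂)
allAdj⇒adj G u v (there i∈is) uv∈⋂ = allAdj⇒adj G u v i∈is (proj₂ (Equivalence.to T-∧ uv∈⋂))

outdegV-intersection-≤ : ∀ {n} (𝒢 : TemporalGraph n) {a b i} C v → i ∈ interval a b →
  outdegV (intersectionGraph 𝒢 a b) C v ≤ outdegV (layer 𝒢 i) C v
outdegV-intersection-≤ 𝒢 {a} {b} {i} C v i∈[a,b] =
  outdegV-mono (intersectionGraph 𝒢 a b) (layer 𝒢 i) C v (λ u → allAdj⇒adj (layer 𝒢) v u i∈[a,b])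

module Isolation {n : ℕ} (c : ℚ) (𝒢 : TemporalGraph n) (C : Subset n) (a b : ℕ) where

  private
    I : List ℕ
    I = interval a b

    M : List (Fin n)
    M = members C

    k L : ℕ
    k = ∣ C ∣
    L = b + 1 ∸ a

    d : ℕ → Fin n → ℕ
    d i = outdegV (layer 𝒢 i) C

    out : Fin n → ℕ
    out = outdegV (intersectionGraph 𝒢 a b) C

    sumOverTime maxOverTime : Fin n → ℕ
    sumOverTime v = sum (map (λ i → d i v) I)
    maxOverTime v = maxL (map (λ i → d i v) I)

    sumOverC maxOverC : ℕ → ℕ
    sumOverC i = sum (map (d i) M)
    maxOverC i = maxL (map (d i) M)

    0<L : a ≤ b → 0 ℕ.< L
    0<L a≤b = subst (0 ℕ.<_) (length-interval a≤b) (s≤s z≤n)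

    sum≤k*max : ∀ g → sum (map g M) ≤ k * maxL (map g M)
    sum≤k*max g = subst (λ m → sum (map g M) ≤ m * maxL (map g M)) (length-members C)
      (sum-map-≤-length*maxL M g)

    sum≤L*max : a ≤ b → ∀ f → sum (map f I) ≤ L * maxL (map f I)
    sum≤L*max a≤b f = subst (λ m → sum (map f I) ≤ m * maxL (map f I)) (length-interval a≤b)
      (sum-map-≤-length*maxL I f)

    L*out≤sumOverTime : a ≤ b → ∀ v → L * out v ≤ sumOverTime v
    L*out≤sumOverTime a≤b v = subst (λ m → m * out v ≤ sumOverTime v) (length-interval a≤b)
      (length*-≤-sum-map I (outdegV-intersection-≤ 𝒢 C v))

  alltimeMax⇒avgAlltime : Nonempty C → AlltimeMaxIsolated c 𝒢 C a b → AvgAlltimeIsolated c 𝒢 C a b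
  alltimeMax⇒avgAlltime C≢∅ =
    ℕ→ℚ-*-≤-<-trans c (nonempty⇒∣p∣>0 C≢∅) (sum≤k*max maxOverTime)

  alltimeMax⇒usuallyMax : a ≤ b → AlltimeMaxIsolated c 𝒢 C a b → UsuallyMaxIsolated c 𝒢 C a b
  alltimeMax⇒usuallyMax a≤b = ℕ→ℚ-*-≤-<-trans c (0<L a≤b)
    (≤-trans (sum≤L*max a≤b maxOverC) (*-monoʳ-≤ L (maxL-map-maxL-≤ M I (λ v i → d i v))))

  avgAlltime⇒alltimeAvg : AvgAlltimeIsolated c 𝒢 C a b → AlltimeAvgIsolated c 𝒢 C a b
  avgAlltime⇒alltimeAvg = ℕ→ℚ-≤-<-trans _ (maxL-map-sum-≤-sum-map-maxL M I (λ v i → d i v))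

  usuallyMax⇒maxUsually : UsuallyMaxIsolated c 𝒢 C a b → MaxUsuallyIsolated c 𝒢 C a b
  usuallyMax⇒maxUsually = ℕ→ℚ-≤-<-trans _ (maxL-map-sum-≤-sum-map-maxL I M d)

  alltimeAvg⇒usuallyAvg : a ≤ b → AlltimeAvgIsolated c 𝒢 C a b → UsuallyAvgIsolated c 𝒢 C a b
  alltimeAvg⇒usuallyAvg a≤b = ℕ→ℚ-*-≤-<-trans (c ℚ.* ℕ→ℚ k) (0<L a≤b) (sum≤L*max a≤b sumOverC)

  maxUsually⇒usuallyAvg : Nonempty C → MaxUsuallyIsolated c 𝒢 C a b → UsuallyAvgIsolated c 𝒢 C a b
  maxUsually⇒usuallyAvg C≢∅ h = subst (ℕ→ℚ (sum (map sumOverC I)) <_) (xy∙z≈xz∙y c (ℕ→ℚ L) (ℕ→ℚ k))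
    (ℕ→ℚ-*-≤-<-trans (c ℚ.* ℕ→ℚ L) (nonempty⇒∣p∣>0 C≢∅) total≤k*max h)
    where
    total≤k*max : sum (map sumOverC I) ≤ k * maxL (map sumOverTime M)
    total≤k*max = subst (_≤ k * maxL (map sumOverTime M))
      (sum-map-comm M I (λ v i → d i v)) (sum≤k*max sumOverTime)

  maxUsually⇒maxIsolated : a ≤ b → MaxUsuallyIsolated c 𝒢 C a b → MaxIsolated c (intersectionGraph 𝒢 a b) C
  maxUsually⇒maxIsolated a≤b = ℕ→ℚ-*-cancel-< c (0<L a≤b) (begin
    L * maxL (map out M)              ≡⟨ maxL-map-* M out L ⟨
    maxL (map (λ v → L * out v) M)    ≤⟨ maxL-map-lub M (λ {v} v∈M →
                                           ≤-trans (L*out≤sumOverTime a≤b v) (≤-maxL-map sumOverTime v∈M)) ⟩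
    maxL (map sumOverTime M)          ∎)
    where open ≤-Reasoning

  usuallyAvg⇒avgIsolated : a ≤ b → UsuallyAvgIsolated c 𝒢 C a b → AvgIsolated c (intersectionGraph 𝒢 a b) C
  usuallyAvg⇒avgIsolated a≤b = ℕ→ℚ-*-cancel-< (c ℚ.* ℕ→ℚ k) (0<L a≤b) (begin
    L * sum (map out M)               ≡⟨ sum-map-* M out L ⟨
    sum (map (λ v → L * out v) M)     ≤⟨ sum-map-mono M (λ _ → L*out≤sumOverTime a≤b _) ⟩
    sum (map sumOverTime M)           ≡⟨ sum-map-comm I M d ⟨
    sum (map sumOverC I)              ∎)
    where open ≤-Reasoning

  maxIsolated⇒avgIsolated : Nonempty C → MaxIsolated c (intersectionGraph 𝒢 a b) C →
                            AvgIsolated c (intersectionGraph 𝒢 a b) C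
  maxIsolated⇒avgIsolated C≢∅ = ℕ→ℚ-*-≤-<-trans c (nonempty⇒∣p∣>0 C≢∅) (sum≤k*max out)

mainTheorem2 : ∀ {n : ℕ} (𝒢 : TemporalGraph n) (a b : ℕ) (C : Subset n) (c : ℚ)
    → 1 ≤ a → a ≤ b → b ≤ τ 𝒢
    → Nonempty C
    → IsClique (intersectionGraph 𝒢 a b) C
    → 0ℚ < c
    → (AlltimeMaxIsolated c 𝒢 C a b → AvgAlltimeIsolated c 𝒢 C a b × UsuallyMaxIsolated c 𝒢 C a b)
    × (AvgAlltimeIsolated c 𝒢 C a b → AlltimeAvgIsolated c 𝒢 C a b)
    × (UsuallyMaxIsolated c 𝒢 C a b → MaxUsuallyIsolated c 𝒢 C a b)
    × (AlltimeAvgIsolated c 𝒢 C a b → UsuallyAvgIsolated c 𝒢 C a b)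
    × (MaxUsuallyIsolated c 𝒢 C a b → UsuallyAvgIsolated c 𝒢 C a b × MaxIsolated c (intersectionGraph 𝒢 a b) C)
    × (UsuallyAvgIsolated c 𝒢 C a b → AvgIsolated c (intersectionGraph 𝒢 a b) C)
    × (MaxIsolated c (intersectionGraph 𝒢 a b) C → AvgIsolated c (intersectionGraph 𝒢 a b) C)
mainTheorem2 𝒢 a b C c _ a≤b _ C≢∅ _ _ =
    (λ h → alltimeMax⇒avgAlltime C≢∅ h , alltimeMax⇒usuallyMax a≤b h)
  , avgAlltime⇒alltimeAvg
  , usuallyMax⇒maxUsually
  , alltimeAvg⇒usuallyAvg a≤b
  , (λ h → maxUsually⇒usuallyAvg C≢∅ h , maxUsually⇒maxIsolated a≤b h)
  , usuallyAvg⇒avgIsolated a≤b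
  , maxIsolated⇒avgIsolated C≢∅
  where open Isolation c 𝒢 C a b
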